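{- Let $f:\mathbb{R}\to\mathbb{R}$ be a nonnegative nondecreasing function and let $G=(A\cup B,E)$ be a bipartite graph on $n$ vertices with average degree $\bar d(G)=2|E|/n\ge 16$. (i) If every pair of vertices of $G$ has $f$-sparse sub-bineighborhoods, then $(\bar d(G))^3\le 2^{11}n f(2\bar d(G))$. (ii) If every pair of adjacent vertices of $G$ has $f$-sparse sub-bineighborhoods and $|E|\ge 25n^{3/2}$, then $(\bar d(G))^3\le 2^{20} n f(2\bar d(G))$.
   Context: For a graph $G$ and vertex $v$, $N_G(v)$ denotes the set of neighbors of $v$. For disjoint vertex sets $U,V$, $G(U,V)$ is the bipartite graph with vertex set $U\cup V$ and edge set $\{uv\in E(G): u\in U, v\in V\}$. Two vertices $u,v$ of $G$ have $f$-sparse sub-bineighborhoods if for every two disjoint subsets $U\subseteq N_G(u)\setminus\{v\}$ and $V\subseteq N_G(v)\setminus\{u\}$ we have $|E(G(U,V))|\le f(|U\cup V|)$.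
   Formalization: The nonnegative nondecreasing function f maps the rationals to the rationals, rather than being a function $f:\mathbb{R}\to\mathbb{R}$. -}

module Defs where

open import Data.Nat using (ℕ; zero; suc; _+_; _*_; _^_; _<_; _≤?_; _<?_; NonZero)
import Data.Nat as ℕ
open import Data.Bool using (Bool; true; false; if_then_else_; _∧_)
open import Data.Fin using (Fin; toℕ)
open import Data.Fin.Subset using (Subset; _∪_; _∩_; ∣_∣; _∈_; Empty)
open import Data.Vec using (lookup)
open import Data.List using (List; map; allFin)
open import Data.Nat.ListAction using (sum)
open import Data.Integer using (+_)
open import Data.Rational using (ℚ; _/_; _≤_; 0ℚ)
import Data.Rational as ℚ
open import Data.Product using (Σ; _×_)
open import Relation.Binary.PropositionalEquality using (_≡_; _≢_)
open import Relation.Nullary.Decidable using (⌊_⌋)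

record Graph (n : ℕ) : Set where
  field
    adj    : Fin n → Fin n → Bool
    sym    : ∀ u v → adj u v ≡ adj v u
    irrefl : ∀ u → adj u u ≡ false
open Graph public

Bipartite : ∀ {n} → Graph n → Set
Bipartite {n} G = Σ (Fin n → Bool) λ side →
  ∀ u v → adj G u v ≡ true → side u ≢ side v

count : ∀ {n} → (Fin n → Bool) → ℕ
count {n} p = sum (map (λ i → if p i then 1 else 0) (allFin n))

count2 : ∀ {n} → (Fin n → Fin n → Bool) → ℕ
count2 {n} p = sum (map (λ x → count (p x)) (allFin n))

numEdges : ∀ {n} → Graph n → ℕ
numEdges G = count2 λ u v → ⌊ toℕ u <? toℕ v ⌋ ∧ adj G u v

avgDeg : ∀ {n} → .{{NonZero n}} → Graph n → ℚ
avgDeg {n} G = + (2 * numEdges G) / n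

bipEdges : ∀ {n} → Graph n → Subset n → Subset n → ℕ
bipEdges G U V = count2 λ x y → lookup U x ∧ lookup V y ∧ adj G x y

ℕtoℚ : ℕ → ℚ
ℕtoℚ k = + k / 1

SparseSubBineighborhoods : ∀ {n} → (ℚ → ℚ) → Graph n → Fin n → Fin n → Set
SparseSubBineighborhoods {n} f G u v =
  (U V : Subset n) →
  (∀ x → x ∈ U → adj G u x ≡ true × x ≢ v) →
  (∀ y → y ∈ V → adj G v y ≡ true × y ≢ u) →
  Empty (U ∩ V) →
  ℕtoℚ (bipEdges G U V) ≤ f (ℕtoℚ ∣ U ∪ V ∣)

NonNegative : (ℚ → ℚ) → Set
NonNegative f = ∀ x → 0ℚ ≤ f x

Nondecreasing : (ℚ → ℚ) → Set
Nondecreasing f = ∀ x y → x ≤ y → f x ≤ f y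

{-# OPTIONS --safe #-}

-- Let m = |E(G)| and choose k with (2k + 1)n ≤ m ≤ 3kn. Deleting vertices of degree at most 2k
-- leaves a nonempty subgraph H of minimum degree above 2k; fix v in H and a set V of k
-- H-neighbors of v. For x outside {v} ∪ V let a(x) be the number of H-neighbors of x in V;
-- since the vertices of V have degree above 2k, these numbers add up to at least k². Averaging
-- over u (in H ∖ V for (i), in V for (ii)) yields a vertex u whose neighbors outside {v} ∪ V
-- have large average a(x), and the k largest of them form a set U sending many edges to V
-- (to V ∖ {u} in (ii)): k⁴ ≤ 2m·e(U, V) in (i), and by Cauchy–Schwarz k³ ≤ n(e(U, V ∖ {u}) + k)
-- in (ii). Sparsity bounds e by f(|U ∪ V|) ≤ f(2d̄), and m ≤ 3kn turns these into the bounds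
-- on d̄³.
module Submission where

-- A submodule, so that theorem32 below can use the operators of ℚ unqualified while the
-- development uses those of ℕ.
module Lemmas where

  open import Data.Nat
    using (ℕ; zero; suc; _+_; _*_; _^_; _∸_; _/_; _%_; _≤_; _<_; _≤?_; _<?_; z≤n; s≤s; z<s; NonZero; >-nonZero)
  open import Data.Nat.Properties hiding (_≟_)
  open import Data.Bool using (Bool; true; false; if_then_else_; _∧_; not)
  open import Data.Fin using (Fin; zero; suc; _≟_; toℕ)
  open import Data.Fin.Properties using (any?; toℕ-injective)
  open import Data.Product using (_×_; _,_; proj₁; proj₂; ∃)
  open import Data.Sum using ([_,_]′)
  open import Data.Empty using (⊥; ⊥-elim)
  open import Function using (_∘_; id; case_of_)
  open import Relation.Nullary using (yes; no; does)
  open import Relation.Nullary.Decidable using (⌊_⌋; _×-dec_)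
  open import Relation.Binary.PropositionalEquality
    using (_≡_; _≢_; refl; sym; trans; cong; cong₂; subst; subst₂; module ≡-Reasoning)
  open import Data.Nat.Solver using (module +-*-Solver)
  open import Data.Nat.DivMod using (m≡m%n+[m/n]*n; m%n<n; m*n/n≡m; /-monoˡ-≤)
  import Data.Bool.Properties as Bool
  import Data.List as List using (map; allFin; tabulate)
  import Data.List.Properties as List using (map-tabulate)
  import Data.Nat.ListAction as List using (sum)
  open import Data.Vec using (tabulate; lookup)
  open import Data.Vec.Properties using (lookup∘tabulate; []=⇒lookup)
  open import Data.Fin.Subset using (_∪_; _∩_; ∣_∣; _∈_; Empty)
  open import Data.Fin.Subset.Properties using (x∈p∩q⁻)
  import Data.Integer as ℤ
  import Data.Integer.Properties as ℤ
  open import Data.Rational using (ℚ)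
  import Data.Rational as ℚ
  import Data.Rational.Properties as ℚ
  import Data.Rational.Unnormalised as ℚᵘ
  import Data.Rational.Unnormalised.Properties as ℚᵘ
  open import Defs renaming (sym to adj-sym)
  open import Algebra.Properties.Semiring.Sum +-*-semiring
    using (sum; sum-syntax; sum-replicate-zero; sum-cong-≗; ∑-distrib-+; ∑-comm; *-distribˡ-sum; *-distribʳ-sum)

  open +-*-Solver

  -- Finite sums

  sum-mono-≤ : ∀ {n} {f g : Fin n → ℕ} → (∀ i → f i ≤ g i) → sum f ≤ sum g
  sum-mono-≤ {zero}  f≤g = z≤n
  sum-mono-≤ {suc n} f≤g = +-mono-≤ (f≤g zero) (sum-mono-≤ (f≤g ∘ suc))

  sum-mono-< : ∀ {n} {f g : Fin n → ℕ} → (∀ i → f i ≤ g i) → ∀ j → f j < g j → sum f < sum g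
  sum-mono-< f≤g zero    fj<gj = +-mono-<-≤ fj<gj (sum-mono-≤ (f≤g ∘ suc))
  sum-mono-< f≤g (suc j) fj<gj = +-mono-≤-< (f≤g zero) (sum-mono-< (f≤g ∘ suc) j fj<gj)

  ∑-const : ∀ n c → ∑[ i < n ] c ≡ n * c
  ∑-const zero    c = refl
  ∑-const (suc n) c = cong (c +_) (∑-const n c)

  ∑-pos⇒∃-pos : ∀ {n} (f : Fin n → ℕ) → 0 < sum f → ∃ λ i → 0 < f i
  ∑-pos⇒∃-pos {suc n} f ∑f>0 with f zero in f₀≡
  ... | suc _ = zero , subst (0 <_) (sym f₀≡) z<s
  ... | zero  with ∑-pos⇒∃-pos (f ∘ suc) ∑f>0
  ...   | i , fi>0 = suc i , fi>0

  -- does rather than ⌊_⌋, so that suc x == suc y reduces to x == y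
  _==_ : ∀ {n} → Fin n → Fin n → Bool
  x == y = does (x ≟ y)

  𝟙 : Bool → ℕ
  𝟙 b = if b then 1 else 0

  ∑-select : ∀ {n} (x : Fin n) (g : Fin n → ℕ) → ∑[ y < n ] (𝟙 (y == x) * g y) ≡ g x
  ∑-select {suc n} zero    g = trans (cong (g zero + 0 +_) (sum-replicate-zero n)) (trans (+-identityʳ _) (+-identityʳ _))
  ∑-select {suc n} (suc x) g = ∑-select {n} x (g ∘ suc)

  ∃-ratio≤mediant : ∀ {n} (f g : Fin n → ℕ) → 0 < sum f →
    ∃ λ i → 0 < f i × g i * sum f ≤ f i * sum g
  ∃-ratio≤mediant {n} f g ∑f>0 with any? (λ i → (0 <? f i) ×-dec (g i * sum f ≤? f i * sum g))
  ... | yes found = found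
  ... | no none = ⊥-elim (<-irrefl cross-sums-equal (sum-mono-< cross≤ j (strict j fj>0)))
    where
    strict : ∀ i → 0 < f i → f i * sum g < g i * sum f
    strict i fi>0 = ≰⇒> (λ le → none (i , fi>0 , le))
    cross≤ : ∀ i → f i * sum g ≤ g i * sum f
    cross≤ i with f i in fi≡
    ... | zero  = z≤n
    ... | suc _ = <⇒≤ (subst (λ t → t * sum g < g i * sum f) fi≡ (strict i (subst (0 <_) (sym fi≡) z<s)))
    j : Fin n
    j = proj₁ (∑-pos⇒∃-pos f ∑f>0)
    fj>0 : 0 < f j
    fj>0 = proj₂ (∑-pos⇒∃-pos f ∑f>0)
    cross-sums-equal : ∑[ i < n ] (f i * sum g) ≡ ∑[ i < n ] (g i * sum f)
    cross-sums-equal = begin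
      ∑[ i < n ] (f i * sum g) ≡⟨ *-distribʳ-sum (sum g) f ⟨
      sum f * sum g            ≡⟨ *-comm (sum f) (sum g) ⟩
      sum g * sum f            ≡⟨ *-distribʳ-sum (sum f) g ⟩
      ∑[ i < n ] (g i * sum f) ∎
      where open ≡-Reasoning

  2*m*n≤m*m+n*n : ∀ m n → 2 * (m * n) ≤ m * m + n * n
  2*m*n≤m*m+n*n m n = [ ordered m n , flipped ]′ (≤-total m n)
    where
    ordered : ∀ m n → m ≤ n → 2 * (m * n) ≤ m * m + n * n
    ordered m n m≤n with m≤n⇒∃[o]m+o≡n m≤n
    ... | t , refl = subst (2 * (m * (m + t)) ≤_)
      (solve 2 (λ m t → con 2 :* (m :* (m :+ t)) :+ t :* t := m :* m :+ (m :+ t) :* (m :+ t)) refl m t)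
      (m≤m+n _ (t * t))
    flipped : n ≤ m → 2 * (m * n) ≤ m * m + n * n
    flipped n≤m = subst₂ _≤_ (cong (2 *_) (*-comm n m)) (+-comm (n * n) (m * m)) (ordered n m n≤m)

  cauchy-schwarz : ∀ {n} (c : Fin n → ℕ) → sum c * sum c ≤ n * ∑[ i < n ] (c i * c i)
  cauchy-schwarz {n} c = *-cancelˡ-≤ 2 (begin
    2 * (sum c * sum c)
      ≡⟨ cong (2 *_) (*-distribʳ-sum (sum c) c) ⟩
    2 * ∑[ i < n ] (c i * sum c)
      ≡⟨ *-distribˡ-sum 2 (λ i → c i * sum c) ⟩
    ∑[ i < n ] (2 * (c i * sum c))
      ≡⟨ sum-cong-≗ (λ i → cong (2 *_) (*-distribˡ-sum (c i) c)) ⟩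
    ∑[ i < n ] (2 * ∑[ j < n ] (c i * c j))
      ≡⟨ sum-cong-≗ (λ i → *-distribˡ-sum 2 (λ j → c i * c j)) ⟩
    ∑[ i < n ] ∑[ j < n ] (2 * (c i * c j))
      ≤⟨ sum-mono-≤ (λ i → sum-mono-≤ (λ j → 2*m*n≤m*m+n*n (c i) (c j))) ⟩
    ∑[ i < n ] ∑[ j < n ] (c i * c i + c j * c j)
      ≡⟨ sum-cong-≗ (λ i → ∑-distrib-+ (λ _ → c i * c i) sq) ⟩
    ∑[ i < n ] (∑[ j < n ] (c i * c i) + sum sq)
      ≡⟨ sum-cong-≗ (λ i → cong (_+ sum sq) (∑-const n (c i * c i))) ⟩
    ∑[ i < n ] (n * (c i * c i) + sum sq)
      ≡⟨ ∑-distrib-+ (λ i → n * sq i) (λ _ → sum sq) ⟩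
    ∑[ i < n ] (n * (c i * c i)) + ∑[ i < n ] (sum sq)
      ≡⟨ cong₂ _+_ (*-distribˡ-sum n sq) (sym (∑-const n (sum sq))) ⟨
    n * sum sq + n * sum sq
      ≡⟨ solve 1 (λ x → x :+ x := con 2 :* x) refl (n * sum sq) ⟩
    2 * (n * sum sq) ∎)
    where
    open ≤-Reasoning
    sq : Fin n → ℕ
    sq i = c i * c i

  -- Finite sets as Boolean predicates

  weight : ∀ {n} → (Fin n → Bool) → (Fin n → ℕ) → ℕ
  weight P w = ∑[ i < _ ] (𝟙 (P i) * w i)

  card : ∀ {n} → (Fin n → Bool) → ℕ
  card P = ∑[ i < _ ] 𝟙 (P i)

  card≡weight-1 : ∀ {n} (P : Fin n → Bool) → card P ≡ weight P (λ _ → 1)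
  card≡weight-1 P = sum-cong-≗ (λ i → sym (*-identityʳ (𝟙 (P i))))

  _⊆_ : ∀ {n} → (Fin n → Bool) → (Fin n → Bool) → Set
  P ⊆ Q = ∀ x → P x ≡ true → Q x ≡ true

  _─_ : ∀ {n} → (Fin n → Bool) → Fin n → Fin n → Bool
  (P ─ x) y = not (y == x) ∧ P y

  ─-⊆ : ∀ {n} (P : Fin n → Bool) x → (P ─ x) ⊆ P
  ─-⊆ P x y P─xy with y == x
  ... | false = P─xy

  x∉P─x : ∀ {n} (P : Fin n → Bool) x → (P ─ x) x ≡ false
  x∉P─x P x with x ≟ x
  ... | yes _   = refl
  ... | no  x≢x = ⊥-elim (x≢x refl)

  𝟙-─ : ∀ {n} (P : Fin n → Bool) {x} → P x ≡ true → ∀ y → 𝟙 (P y) ≡ 𝟙 ((P ─ x) y) + 𝟙 (y == x)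
  𝟙-─ P {x} Px y with y ≟ x
  ... | yes refl rewrite Px = refl
  ... | no _     = sym (+-identityʳ _)

  weight-─ : ∀ {n} (P : Fin n → Bool) {x} → P x ≡ true → ∀ w → weight P w ≡ weight (P ─ x) w + w x
  weight-─ {n} P {x} Px w = begin
    weight P w
      ≡⟨ sum-cong-≗ (λ y → cong (_* w y) (𝟙-─ P Px y)) ⟩
    ∑[ y < n ] ((𝟙 ((P ─ x) y) + 𝟙 (y == x)) * w y)
      ≡⟨ sum-cong-≗ (λ y → *-distribʳ-+ (w y) (𝟙 ((P ─ x) y)) _) ⟩
    ∑[ y < n ] (𝟙 ((P ─ x) y) * w y + 𝟙 (y == x) * w y)
      ≡⟨ ∑-distrib-+ (λ y → 𝟙 ((P ─ x) y) * w y) _ ⟩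
    weight (P ─ x) w + ∑[ y < n ] (𝟙 (y == x) * w y)
      ≡⟨ cong (weight (P ─ x) w +_) (∑-select x w) ⟩
    weight (P ─ x) w + w x ∎
    where open ≡-Reasoning

  card-─ : ∀ {n} (P : Fin n → Bool) {x} → P x ≡ true → card P ≡ suc (card (P ─ x))
  card-─ P {x} Px = begin
    card P                          ≡⟨ card≡weight-1 P ⟩
    weight P (λ _ → 1)              ≡⟨ weight-─ P Px _ ⟩
    weight (P ─ x) (λ _ → 1) + 1    ≡⟨ cong (_+ 1) (card≡weight-1 (P ─ x)) ⟨
    card (P ─ x) + 1                ≡⟨ +-comm _ 1 ⟩
    suc (card (P ─ x))              ∎
    where open ≡-Reasoning

  𝟙-∧ : ∀ a b → 𝟙 (a ∧ b) ≡ 𝟙 a * 𝟙 b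
  𝟙-∧ true  b = sym (+-identityʳ (𝟙 b))
  𝟙-∧ false b = refl

  𝟙≤1 : ∀ b → 𝟙 b ≤ 1
  𝟙≤1 true  = ≤-refl
  𝟙≤1 false = z≤n

  𝟙*m≤m : ∀ b m → 𝟙 b * m ≤ m
  𝟙*m≤m true  m = ≤-reflexive (+-identityʳ m)
  𝟙*m≤m false m = z≤n

  weight-mono-≤ : ∀ {n} (P : Fin n → Bool) {f g : Fin n → ℕ} →
    (∀ x → P x ≡ true → f x ≤ g x) → weight P f ≤ weight P g
  weight-mono-≤ P {f} {g} f≤g = sum-mono-≤ pointwise
    where
    pointwise : ∀ x → 𝟙 (P x) * f x ≤ 𝟙 (P x) * g x
    pointwise x with P x in Px
    ... | true  = *-monoʳ-≤ 1 (f≤g x Px)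
    ... | false = z≤n

  weight≤sum : ∀ {n} (P : Fin n → Bool) (f : Fin n → ℕ) → weight P f ≤ sum f
  weight≤sum P f = sum-mono-≤ (λ x → 𝟙*m≤m (P x) (f x))

  weight-const : ∀ {n} (P : Fin n → Bool) c → weight P (λ _ → c) ≡ card P * c
  weight-const P c = sym (*-distribʳ-sum c (𝟙 ∘ P))

  card-mono : ∀ {n} {P Q : Fin n → Bool} → P ⊆ Q → card P ≤ card Q
  card-mono {P = P} {Q} P⊆Q = sum-mono-≤ pointwise
    where
    pointwise : ∀ x → 𝟙 (P x) ≤ 𝟙 (Q x)
    pointwise x with P x in Px
    ... | true  rewrite P⊆Q x Px = ≤-refl
    ... | false = z≤n

  ∃-member-ratio≥ : ∀ {n} (R : Fin n → Bool) (F D : Fin n → ℕ) → 0 < weight R F →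
    ∃ λ u → R u ≡ true × D u * weight R F ≤ F u * weight R D
  ∃-member-ratio≥ R F D weight>0 with ∃-ratio≤mediant (λ i → 𝟙 (R i) * F i) (λ i → 𝟙 (R i) * D i) weight>0
  ... | u , term>0 , ratio with R u in Ru
  ...   | true  = u , Ru ,
    subst₂ _≤_ (cong (_* weight R F) (*-identityˡ (D u))) (cong (_* weight R D) (*-identityˡ (F u))) ratio
  ...   | false = ⊥-elim (<-irrefl refl term>0)

  heavy-subset-step : ∀ k d s x u → k ≤ d → d * x ≤ s → k * s ≤ d * u → k * (s + x) ≤ suc d * u
  heavy-subset-step zero    d s x u _   _    _    = z≤n
  heavy-subset-step (suc k) d s x u k≤d dx≤s ks≤du = begin
    suc k * (s + x)          ≡⟨ *-distribˡ-+ (suc k) s x ⟩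
    suc k * s + suc k * x    ≤⟨ +-mono-≤ ks≤du kx≤u ⟩
    d * u + u                ≡⟨ +-comm (d * u) u ⟩
    suc d * u                ∎
    where
    open ≤-Reasoning
    instance
      d≢0 : NonZero d
      d≢0 = >-nonZero (<-≤-trans z<s k≤d)
    kx≤u : suc k * x ≤ u
    kx≤u = *-cancelˡ-≤ d (begin
      d * (suc k * x)    ≡⟨ solve 3 (λ d k x → d :* (k :* x) := k :* (d :* x)) refl d (suc k) x ⟩
      suc k * (d * x)    ≤⟨ *-monoʳ-≤ (suc k) dx≤s ⟩
      suc k * s          ≤⟨ ks≤du ⟩
      d * u              ∎)

  -- Discard a member of at most average weight until k members remain.
  ∃-heavy-subset : ∀ {n} (w : Fin n → ℕ) k (N : Fin n → Bool) → k ≤ card N →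
    ∃ λ U → U ⊆ N × card U ≡ k × k * weight N w ≤ card N * weight U w
  ∃-heavy-subset w k N k≤|N| with m≤n⇒∃[o]m+o≡n k≤|N|
  ... | t , k+t≡|N| = peel t N (trans (sym k+t≡|N|) (+-comm k t))
    where
    peel : ∀ t N → card N ≡ t + k → ∃ λ U → U ⊆ N × card U ≡ k × k * weight N w ≤ card N * weight U w
    peel zero    N |N|≡k = N , (λ _ Nx → Nx) , |N|≡k , ≤-reflexive (cong (_* weight N w) (sym |N|≡k))
    peel (suc t) N |N|≡ with ∃-member-ratio≥ N (λ _ → 1) w (subst (0 <_) (trans (sym |N|≡) (card≡weight-1 N)) z<s)
    ... | x , Nx , x-light with peel t (N ─ x) (suc-injective (trans (sym (card-─ N Nx)) |N|≡))
    ...   | U , U⊆N─x , |U|≡k , U-heavy = U , (λ y → ─-⊆ N x y ∘ U⊆N─x y) , |U|≡k , U-heavy′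
      where
      U-heavy′ : k * weight N w ≤ card N * weight U w
      U-heavy′ = subst₂ _≤_ (cong (k *_) (sym (weight-─ N Nx w))) (cong (_* weight U w) (sym (card-─ N Nx)))
        (heavy-subset-step k d s (w x) (weight U w) k≤d dx≤s U-heavy)
        where
        open ≤-Reasoning
        d s : ℕ
        d = card (N ─ x)
        s = weight (N ─ x) w
        k≤d : k ≤ d
        k≤d = subst (k ≤_) (sym (suc-injective (trans (sym (card-─ N Nx)) |N|≡))) (m≤n+m k t)
        dx≤s : d * w x ≤ s
        dx≤s = +-cancelˡ-≤ (w x) _ _ (begin
          w x + d * w x               ≡⟨ *-comm (suc d) (w x) ⟩
          w x * suc d                 ≡⟨ cong (w x *_) (card-─ N Nx) ⟨
          w x * card N                ≡⟨ cong (w x *_) (card≡weight-1 N) ⟩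
          w x * weight N (λ _ → 1)    ≤⟨ x-light ⟩
          1 * weight N w              ≡⟨ *-identityˡ _ ⟩
          weight N w                  ≡⟨ weight-─ N Nx w ⟩
          s + w x                     ≡⟨ +-comm s (w x) ⟩
          w x + s                     ∎)

  ∃-subset-of-card : ∀ {n} k (N : Fin n → Bool) → k ≤ card N → ∃ λ U → U ⊆ N × card U ≡ k
  ∃-subset-of-card k N k≤|N| =
    let U , U⊆N , |U|≡k , _ = ∃-heavy-subset (λ _ → 0) k N k≤|N| in U , U⊆N , |U|≡k

  -- Graphs

  List-sum-allFin : ∀ n (f : Fin n → ℕ) → List.sum (List.map f (List.allFin n)) ≡ sum f
  List-sum-allFin n f = trans (cong List.sum (List.map-tabulate id f)) (sum-tabulate n f)
    where
    sum-tabulate : ∀ n (f : Fin n → ℕ) → List.sum (List.tabulate f) ≡ sum f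
    sum-tabulate zero    f = refl
    sum-tabulate (suc n) f = cong (f zero +_) (sum-tabulate n (f ∘ suc))

  count≡card : ∀ {n} (p : Fin n → Bool) → count p ≡ card p
  count≡card {n} p = List-sum-allFin n (𝟙 ∘ p)

  count2≡∑card : ∀ {n} (p : Fin n → Fin n → Bool) → count2 p ≡ ∑[ x < n ] card (p x)
  count2≡∑card {n} p = trans (List-sum-allFin n (count ∘ p)) (sum-cong-≗ (count≡card ∘ p))

  degree : ∀ {n} → Graph n → Fin n → ℕ
  degree G x = card (adj G x)

  degreeSum : ∀ {n} → Graph n → ℕ
  degreeSum G = sum (degree G)

  degreeSum≡2*numEdges : ∀ {n} (G : Graph n) → degreeSum G ≡ 2 * numEdges G
  degreeSum≡2*numEdges {n} G = begin
    ∑[ u < n ] ∑[ v < n ] 𝟙 (adj G u v)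
      ≡⟨ sum-cong-≗ (λ u → sum-cong-≗ (split u)) ⟩
    ∑[ u < n ] ∑[ v < n ] (𝟙 (forward u v) + 𝟙 (forward v u))
      ≡⟨ sum-cong-≗ (λ u → ∑-distrib-+ (𝟙 ∘ forward u) _) ⟩
    ∑[ u < n ] (card (forward u) + ∑[ v < n ] 𝟙 (forward v u))
      ≡⟨ ∑-distrib-+ (card ∘ forward) _ ⟩
    E + ∑[ u < n ] ∑[ v < n ] 𝟙 (forward v u)
      ≡⟨ cong (E +_) (∑-comm (λ u v → 𝟙 (forward v u))) ⟩
    E + E
      ≡⟨ cong (E +_) (+-identityʳ E) ⟨
    2 * E
      ≡⟨ cong (2 *_) (count2≡∑card forward) ⟨
    2 * numEdges G ∎
    where
    open ≡-Reasoning
    forward : Fin n → Fin n → Bool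
    forward u v = ⌊ toℕ u <? toℕ v ⌋ ∧ adj G u v
    E : ℕ
    E = ∑[ u < n ] card (forward u)
    split : ∀ u v → 𝟙 (adj G u v) ≡ 𝟙 (forward u v) + 𝟙 (forward v u)
    split u v with toℕ u <? toℕ v | toℕ v <? toℕ u
    ... | yes u<v | yes v<u = ⊥-elim (<-asym u<v v<u)
    ... | yes _   | no  _   = sym (+-identityʳ _)
    ... | no  _   | yes _   rewrite adj-sym G u v = refl
    ... | no  u≮v | no  v≮u rewrite toℕ-injective (≤-antisym (≮⇒≥ v≮u) (≮⇒≥ u≮v)) | irrefl G v = refl

  -- The subgraph induced by W, kept on the vertex set Fin n: vertices outside W become isolated.
  _[_] : ∀ {n} → Graph n → (Fin n → Bool) → Graph n
  G [ W ] = record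
    { adj    = λ x y → W x ∧ W y ∧ adj G x y
    ; sym    = symmetric
    ; irrefl = irreflexive
    }
    where
    symmetric : ∀ x y → W x ∧ W y ∧ adj G x y ≡ W y ∧ W x ∧ adj G y x
    symmetric x y rewrite adj-sym G x y with W x | W y
    ... | true  | true  = refl
    ... | true  | false = refl
    ... | false | true  = refl
    ... | false | false = refl
    irreflexive : ∀ x → W x ∧ W x ∧ adj G x x ≡ false
    irreflexive x rewrite irrefl G x with W x
    ... | true  = refl
    ... | false = refl

  adj-[]⁻ : ∀ {n} (G : Graph n) (W : Fin n → Bool) {x y} → adj (G [ W ]) x y ≡ true →
    W x ≡ true × W y ≡ true × adj G x y ≡ true
  adj-[]⁻ G W {x} {y} Hxy with W x | W y | adj G x y | Hxy
  ... | true  | true  | true  | _  = refl , refl , refl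
  ... | true  | true  | false | ()
  ... | true  | false | _     | ()
  ... | false | _     | _     | ()

  degree>0⇒member : ∀ {n} (G : Graph n) (W : Fin n → Bool) {x} → 0 < degree (G [ W ]) x → W x ≡ true
  degree>0⇒member {n} G W {x} deg>0 with W x
  ... | true  = refl
  ... | false = ⊥-elim (<-irrefl (sym (sum-replicate-zero n)) deg>0)

  degree-─ : ∀ {n} (G : Graph n) (W : Fin n → Bool) x a →
    degree (G [ W ]) a ≡ degree (G [ W ─ x ]) a + 𝟙 (a == x) * degree (G [ W ]) a + 𝟙 (adj (G [ W ]) a x)
  degree-─ {n} G W x a = begin
    ∑[ b < n ] 𝟙 (H a b)
      ≡⟨ sum-cong-≗ split ⟩
    ∑[ b < n ] (𝟙 (H′ a b) + 𝟙 (a == x) * 𝟙 (H a b) + 𝟙 (b == x) * 𝟙 (H a b))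
      ≡⟨ ∑-distrib-+ (λ b → 𝟙 (H′ a b) + 𝟙 (a == x) * 𝟙 (H a b)) _ ⟩
    ∑[ b < n ] (𝟙 (H′ a b) + 𝟙 (a == x) * 𝟙 (H a b)) + ∑[ b < n ] (𝟙 (b == x) * 𝟙 (H a b))
      ≡⟨ cong₂ _+_ (∑-distrib-+ (𝟙 ∘ H′ a) _) (∑-select x (𝟙 ∘ H a)) ⟩
    card (H′ a) + ∑[ b < n ] (𝟙 (a == x) * 𝟙 (H a b)) + 𝟙 (H a x)
      ≡⟨ cong (λ t → card (H′ a) + t + 𝟙 (H a x)) (*-distribˡ-sum (𝟙 (a == x)) (𝟙 ∘ H a)) ⟨
    card (H′ a) + 𝟙 (a == x) * card (H a) + 𝟙 (H a x) ∎
    where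
    open ≡-Reasoning
    H H′ : Fin n → Fin n → Bool
    H  = adj (G [ W ])
    H′ = adj (G [ W ─ x ])
    split : ∀ b → 𝟙 (H a b) ≡ 𝟙 (H′ a b) + 𝟙 (a == x) * 𝟙 (H a b) + 𝟙 (b == x) * 𝟙 (H a b)
    split b with a ≟ x | b ≟ x
    ... | yes refl | yes refl rewrite irrefl (G [ W ]) a = refl
    ... | yes refl | no  _    = sym (trans (+-identityʳ _) (+-identityʳ _))
    ... | no  _    | no  _    = sym (trans (+-identityʳ _) (+-identityʳ _))
    ... | no  _    | yes refl with W a
    ...   | true  = sym (+-identityʳ _)
    ...   | false = refl

  degreeSum-─ : ∀ {n} (G : Graph n) (W : Fin n → Bool) x →
    degreeSum (G [ W ]) ≡ degreeSum (G [ W ─ x ]) + 2 * degree (G [ W ]) x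
  degreeSum-─ {n} G W x = begin
    ∑[ a < n ] degree H a
      ≡⟨ sum-cong-≗ (degree-─ G W x) ⟩
    ∑[ a < n ] (degree H′ a + 𝟙 (a == x) * degree H a + 𝟙 (adj H a x))
      ≡⟨ ∑-distrib-+ (λ a → degree H′ a + 𝟙 (a == x) * degree H a) _ ⟩
    ∑[ a < n ] (degree H′ a + 𝟙 (a == x) * degree H a) + ∑[ a < n ] 𝟙 (adj H a x)
      ≡⟨ cong₂ _+_ (∑-distrib-+ (degree H′) _) (sum-cong-≗ (λ a → cong 𝟙 (adj-sym H a x))) ⟩
    degreeSum H′ + ∑[ a < n ] (𝟙 (a == x) * degree H a) + degree H x
      ≡⟨ cong (λ t → degreeSum H′ + t + degree H x) (∑-select x (degree H)) ⟩
    degreeSum H′ + degree H x + degree H x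
      ≡⟨ solve 2 (λ s d → s :+ d :+ d := s :+ con 2 :* d) refl (degreeSum H′) (degree H x) ⟩
    degreeSum H′ + 2 * degree H x ∎
    where
    open ≡-Reasoning
    H H′ : Graph n
    H  = G [ W ]
    H′ = G [ W ─ x ]

  card-full : ∀ n → card {n} (λ _ → true) ≡ n
  card-full n = trans (∑-const n 1) (*-identityʳ n)

  -- Invariant W gives degreeSum (G [ W ]) ≥ degreeSum G − 2cn, however many vertices of degree
  -- at most c have been peeled off.
  module Peeling {n} (G : Graph n) (c : ℕ) where

    Invariant : (Fin n → Bool) → Set
    Invariant W = degreeSum G + 2 * c * card W ≤ degreeSum (G [ W ]) + 2 * c * n

    invariant-─ : ∀ W x → W x ≡ true → degree (G [ W ]) x ≤ c → Invariant W → Invariant (W ─ x)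
    invariant-─ W x Wx deg≤c inv = +-cancelʳ-≤ (2 * c) _ _ (begin
      degreeSum G + 2 * c * card (W ─ x) + 2 * c
        ≡⟨ solve 3 (λ s c a → s :+ con 2 :* c :* a :+ con 2 :* c := s :+ con 2 :* c :* (con 1 :+ a))
                   refl (degreeSum G) c (card (W ─ x)) ⟩
      degreeSum G + 2 * c * suc (card (W ─ x))
        ≡⟨ cong (λ t → degreeSum G + 2 * c * t) (card-─ W Wx) ⟨
      degreeSum G + 2 * c * card W
        ≤⟨ inv ⟩
      degreeSum (G [ W ]) + 2 * c * n
        ≡⟨ cong (_+ 2 * c * n) (degreeSum-─ G W x) ⟩
      degreeSum (G [ W ─ x ]) + 2 * degree (G [ W ]) x + 2 * c * n
        ≤⟨ +-monoˡ-≤ (2 * c * n) (+-monoʳ-≤ (degreeSum (G [ W ─ x ])) (*-monoʳ-≤ 2 deg≤c)) ⟩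
      degreeSum (G [ W ─ x ]) + 2 * c + 2 * c * n
        ≡⟨ solve 3 (λ s c n → s :+ con 2 :* c :+ con 2 :* c :* n := s :+ con 2 :* c :* n :+ con 2 :* c)
                   refl (degreeSum (G [ W ─ x ])) c n ⟩
      degreeSum (G [ W ─ x ]) + 2 * c * n + 2 * c ∎)
      where open ≤-Reasoning

    peel : ∀ t W → card W ≡ t → Invariant W →
      ∃ λ W′ → Invariant W′ × (∀ x → W′ x ≡ true → c < degree (G [ W′ ]) x)
    peel t W |W|≡t inv with any? (λ x → (W x Bool.≟ true) ×-dec (degree (G [ W ]) x ≤? c))
    peel t       W |W|≡t inv | no  none = W , inv , λ x Wx → ≰⇒> (λ deg≤c → none (x , Wx , deg≤c))
    peel zero    W |W|≡0 inv | yes (x , Wx , _) = ⊥-elim (0≢1+n (trans (sym |W|≡0) (card-─ W Wx)))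
    peel (suc t) W |W|≡ inv  | yes (x , Wx , deg≤c) =
      peel t (W ─ x) (suc-injective (trans (sym (card-─ W Wx)) |W|≡)) (invariant-─ W x Wx deg≤c inv)

  ∃-subgraph-minDegree> : ∀ {n} (G : Graph n) c → 2 * c * n < degreeSum G →
    ∃ λ W → (∀ x → W x ≡ true → c < degree (G [ W ]) x) × ∃ λ v → W v ≡ true
  ∃-subgraph-minDegree> {n} G c dense =
    let open Peeling G c
        W , inv , minDegree = peel n (λ _ → true) (card-full n)
                                (≤-reflexive (cong (λ t → degreeSum G + 2 * c * t) (card-full n)))
        v , deg>0 = ∑-pos⇒∃-pos (degree (G [ W ]))
                      (+-cancelʳ-< (2 * c * n) 0 _ (<-≤-trans dense (≤-trans (m≤m+n _ _) inv)))
    in W , minDegree , v , degree>0⇒member G W deg>0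

  -- Sub-bineighborhoods

  crossEdges : ∀ {n} → Graph n → (Fin n → Bool) → (Fin n → Bool) → ℕ
  crossEdges {n} G U V = ∑[ x < n ] card (λ y → U x ∧ V y ∧ adj G x y)

  bipEdges≡crossEdges : ∀ {n} (G : Graph n) (U V : Fin n → Bool) →
    bipEdges G (tabulate U) (tabulate V) ≡ crossEdges G U V
  bipEdges≡crossEdges G U V =
    trans (count2≡∑card (λ x y → lookup (tabulate U) x ∧ lookup (tabulate V) y ∧ adj G x y))
      (sum-cong-≗ (λ x → sum-cong-≗ (λ y →
        cong₂ (λ a b → 𝟙 (a ∧ b ∧ adj G x y)) (lookup∘tabulate U x) (lookup∘tabulate V y))))

  ∣tabulate∪tabulate∣≤ : ∀ {n} (U V : Fin n → Bool) → ∣ tabulate U ∪ tabulate V ∣ ≤ card U + card V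
  ∣tabulate∪tabulate∣≤ {zero}  U V = z≤n
  ∣tabulate∪tabulate∣≤ {suc n} U V with U zero | V zero | ∣tabulate∪tabulate∣≤ (U ∘ suc) (V ∘ suc)
  ... | true  | true  | ih = s≤s (≤-trans ih (+-monoʳ-≤ (card (U ∘ suc)) (n≤1+n _)))
  ... | true  | false | ih = s≤s ih
  ... | false | true  | ih = ≤-trans (s≤s ih) (≤-reflexive (sym (+-suc _ _)))
  ... | false | false | ih = ih

  record SubBineighborhoods {n} (G : Graph n) (u v : Fin n) (U V : Fin n → Bool) : Set where
    field
      U⊆N[u]∖v : ∀ x → U x ≡ true → adj G u x ≡ true × x ≢ v
      V⊆N[v]∖u : ∀ y → V y ≡ true → adj G v y ≡ true × y ≢ u
      disjoint  : ∀ x → U x ≡ true → V x ≡ true → ⊥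

  crossEdges≤f∣U∪V∣ : ∀ {n} (f : ℚ → ℚ) {G : Graph n} {u v U V} → SparseSubBineighborhoods f G u v →
    SubBineighborhoods G u v U V → ℕtoℚ (crossEdges G U V) ℚ.≤ f (ℕtoℚ ∣ tabulate U ∪ tabulate V ∣)
  crossEdges≤f∣U∪V∣ f {G} {U = U} {V} sparse B =
    subst (λ e → ℕtoℚ e ℚ.≤ _) (bipEdges≡crossEdges G U V)
      (sparse (tabulate U) (tabulate V)
        (λ x → U⊆N[u]∖v x ∘ ∈-tabulate U) (λ y → V⊆N[v]∖u y ∘ ∈-tabulate V) disjoint′)
    where
    open SubBineighborhoods B
    ∈-tabulate : ∀ P {x} → x ∈ tabulate P → P x ≡ true
    ∈-tabulate P {x} x∈P = trans (sym (lookup∘tabulate P x)) ([]=⇒lookup x∈P)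
    disjoint′ : Empty (tabulate U ∩ tabulate V)
    disjoint′ (x , x∈U∩V) with x∈p∩q⁻ (tabulate U) (tabulate V) x∈U∩V
    ... | x∈U , x∈V = disjoint x (∈-tabulate U x∈U) (∈-tabulate V x∈V)

  -- The counting argument

  ratio-transfer : ∀ k d s y T D → k ≤ d → d * T ≤ s * D → k * s ≤ d * y → k * T ≤ y * D
  ratio-transfer zero    d s y T D _   _       _       = z≤n
  ratio-transfer (suc k) d s y T D k≤d dT≤sD ks≤dy = *-cancelˡ-≤ d (begin
    d * (suc k * T)    ≡⟨ solve 3 (λ d k T → d :* (k :* T) := k :* (d :* T)) refl d (suc k) T ⟩
    suc k * (d * T)    ≤⟨ *-monoʳ-≤ (suc k) dT≤sD ⟩
    suc k * (s * D)    ≡⟨ *-assoc (suc k) s D ⟨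
    suc k * s * D      ≤⟨ *-monoˡ-≤ D ks≤dy ⟩
    d * y * D          ≡⟨ *-assoc d y D ⟩
    d * (y * D)        ∎)
    where
    open ≤-Reasoning
    instance
      d≢0 : NonZero d
      d≢0 = >-nonZero (<-≤-trans z<s k≤d)

  record Core {n} (G : Graph n) (k : ℕ) : Set where
    field
      W         : Fin n → Bool
      minDegree : ∀ x → W x ≡ true → 2 * k < degree (G [ W ]) x
      v         : Fin n
      V         : Fin n → Bool
      V⊆N[v]    : V ⊆ adj (G [ W ]) v
      |V|≡k     : card V ≡ k

  ∃-core : ∀ {n} (G : Graph n) k → 0 < n → suc (2 * k) * n ≤ numEdges G → Core G k
  ∃-core {n} G k n>0 [2k+1]n≤m =
    let W , minDegree , v , v∈W = ∃-subgraph-minDegree> G (2 * k) dense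
        V , V⊆N[v] , |V|≡k = ∃-subset-of-card k (adj (G [ W ]) v) (≤-trans (m≤m+n k (k + 0)) (<⇒≤ (minDegree v v∈W)))
    in record { W = W ; minDegree = minDegree ; v = v ; V = V ; V⊆N[v] = V⊆N[v] ; |V|≡k = |V|≡k }
    where
    open ≤-Reasoning
    dense : 2 * (2 * k) * n < degreeSum G
    dense = begin-strict
      2 * (2 * k) * n          ≡⟨ *-assoc 2 (2 * k) n ⟩
      2 * (2 * k * n)          <⟨ *-monoʳ-< 2 (m<n+m (2 * k * n) n>0) ⟩
      2 * (suc (2 * k) * n)    ≤⟨ *-monoʳ-≤ 2 [2k+1]n≤m ⟩
      2 * numEdges G           ≡⟨ degreeSum≡2*numEdges G ⟨
      degreeSum G              ∎

  module Counting {n} {G : Graph n} {k} (core : Core G k) where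

    open Core core public

    H : Fin n → Fin n → Bool
    H = adj (G [ W ])

    rest : Fin n → Bool
    rest x = not (x == v) ∧ not (V x)

    N-rest : Fin n → Fin n → Bool
    N-rest u x = H u x ∧ rest x

    degIn : (Fin n → Bool) → Fin n → ℕ
    degIn R x = weight R (𝟙 ∘ H x)

    V⊆W : V ⊆ W
    V⊆W y = proj₁ ∘ proj₂ ∘ adj-[]⁻ G W ∘ V⊆N[v] y

    degIn≤card : ∀ R x → degIn R x ≤ card R
    degIn≤card R x = sum-mono-≤ (λ y → ≤-trans (*-monoʳ-≤ (𝟙 (R y)) (𝟙≤1 (H x y))) (≤-reflexive (*-identityʳ _)))

    ∑-degIn : ∀ R → sum (degIn R) ≡ weight R (degree (G [ W ]))
    ∑-degIn R = begin
      ∑[ x < n ] ∑[ y < n ] (𝟙 (R y) * 𝟙 (H x y))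
        ≡⟨ ∑-comm (λ x y → 𝟙 (R y) * 𝟙 (H x y)) ⟩
      ∑[ y < n ] ∑[ x < n ] (𝟙 (R y) * 𝟙 (H x y))
        ≡⟨ sum-cong-≗ (λ y → *-distribˡ-sum (𝟙 (R y)) (λ x → 𝟙 (H x y))) ⟨
      ∑[ y < n ] (𝟙 (R y) * ∑[ x < n ] 𝟙 (H x y))
        ≡⟨ sum-cong-≗ (λ y → cong (𝟙 (R y) *_) (sum-cong-≗ (λ x → cong 𝟙 (adj-sym (G [ W ]) x y)))) ⟩
      weight R (degree (G [ W ])) ∎
      where open ≡-Reasoning

    degIn-V≤k : ∀ x → degIn V x ≤ k
    degIn-V≤k x = subst (degIn V x ≤_) |V|≡k (degIn≤card V x)

    degIn-split : ∀ x → degIn V x ≤ 𝟙 (rest x) * degIn V x + 𝟙 (x == v) * k + 𝟙 (V x) * k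
    degIn-split x with x ≟ v | V x
    ... | yes refl | Vx    = ≤-trans (degIn-V≤k x) (≤-trans (m≤m+n k 0) (m≤m+n (k + 0) (𝟙 Vx * k)))
    ... | no  _    | true  = ≤-trans (degIn-V≤k x) (m≤m+n k 0)
    ... | no  _    | false = ≤-trans (≤-reflexive (sym (*-identityˡ _))) (≤-trans (m≤m+n _ _) (m≤m+n _ _))

    -- The k vertices of V have degree above 2k in H, and at most k + k² of these edges end at v
    -- or in V.
    k*k≤weight-rest : k * k ≤ weight rest (degIn V)
    k*k≤weight-rest = +-cancelʳ-≤ (k + k * k) _ _ (begin
      k * k + (k + k * k)
        ≡⟨ solve 1 (λ k → k :* k :+ (k :+ k :* k) := k :* (con 1 :+ con 2 :* k)) refl k ⟩
      k * suc (2 * k)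
        ≡⟨ cong (_* suc (2 * k)) |V|≡k ⟨
      card V * suc (2 * k)
        ≡⟨ weight-const V (suc (2 * k)) ⟨
      weight V (λ _ → suc (2 * k))
        ≤⟨ weight-mono-≤ V (λ y → minDegree y ∘ V⊆W y) ⟩
      weight V (degree (G [ W ]))
        ≡⟨ ∑-degIn V ⟨
      sum (degIn V)
        ≤⟨ sum-mono-≤ degIn-split ⟩
      ∑[ x < n ] (𝟙 (rest x) * degIn V x + 𝟙 (x == v) * k + 𝟙 (V x) * k)
        ≡⟨ ∑-distrib-+ (λ x → 𝟙 (rest x) * degIn V x + 𝟙 (x == v) * k) _ ⟩
      ∑[ x < n ] (𝟙 (rest x) * degIn V x + 𝟙 (x == v) * k) + weight V (λ _ → k)
        ≡⟨ cong₂ _+_ (∑-distrib-+ (λ x → 𝟙 (rest x) * degIn V x) _) (trans (weight-const V k) (cong (_* k) |V|≡k)) ⟩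
      weight rest (degIn V) + ∑[ x < n ] (𝟙 (x == v) * k) + k * k
        ≡⟨ cong (λ t → weight rest (degIn V) + t + k * k) (∑-select v (λ _ → k)) ⟩
      weight rest (degIn V) + k + k * k
        ≡⟨ +-assoc _ k (k * k) ⟩
      weight rest (degIn V) + (k + k * k) ∎)
      where open ≤-Reasoning

    k≤card-N-rest : ∀ u → W u ≡ true → k ≤ card (N-rest u)
    k≤card-N-rest u Wu = +-cancelʳ-≤ (suc k) _ _ (begin
      k + suc k
        ≡⟨ +-suc k k ⟩
      suc (k + k)
        ≡⟨ cong suc (cong (k +_) (+-identityʳ k)) ⟨
      suc (2 * k)
        ≤⟨ minDegree u Wu ⟩
      degree (G [ W ]) u
        ≤⟨ sum-mono-≤ split ⟩
      ∑[ x < n ] (𝟙 (N-rest u x) + 𝟙 (x == v) + 𝟙 (V x))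
        ≡⟨ ∑-distrib-+ (λ x → 𝟙 (N-rest u x) + 𝟙 (x == v)) _ ⟩
      ∑[ x < n ] (𝟙 (N-rest u x) + 𝟙 (x == v)) + card V
        ≡⟨ cong₂ _+_ (∑-distrib-+ (𝟙 ∘ N-rest u) _) |V|≡k ⟩
      card (N-rest u) + ∑[ x < n ] 𝟙 (x == v) + k
        ≡⟨ cong (λ t → card (N-rest u) + t + k) (trans (card≡weight-1 (_== v)) (∑-select v (λ _ → 1))) ⟩
      card (N-rest u) + 1 + k
        ≡⟨ +-assoc (card (N-rest u)) 1 k ⟩
      card (N-rest u) + suc k ∎)
      where
      open ≤-Reasoning
      split : ∀ x → 𝟙 (H u x) ≤ 𝟙 (N-rest u x) + 𝟙 (x == v) + 𝟙 (V x)
      split x with H u x | x ≟ v | V x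
      ... | false | _      | _     = z≤n
      ... | true  | yes _  | _     = s≤s z≤n
      ... | true  | no _   | true  = s≤s z≤n
      ... | true  | no _   | false = s≤s z≤n

    weight-N-rest-swap : ∀ R F → weight R (λ u → weight (N-rest u) F) ≡ weight rest (λ x → F x * degIn R x)
    weight-N-rest-swap R F = begin
      ∑[ u < n ] (𝟙 (R u) * ∑[ x < n ] (𝟙 (N-rest u x) * F x))
        ≡⟨ sum-cong-≗ (λ u → *-distribˡ-sum (𝟙 (R u)) (λ x → 𝟙 (N-rest u x) * F x)) ⟩
      ∑[ u < n ] ∑[ x < n ] (𝟙 (R u) * (𝟙 (N-rest u x) * F x))
        ≡⟨ sum-cong-≗ (λ u → sum-cong-≗ (reorder u)) ⟩
      ∑[ u < n ] ∑[ x < n ] (𝟙 (rest x) * F x * (𝟙 (R u) * 𝟙 (H x u)))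
        ≡⟨ ∑-comm (λ u x → 𝟙 (rest x) * F x * (𝟙 (R u) * 𝟙 (H x u))) ⟩
      ∑[ x < n ] ∑[ u < n ] (𝟙 (rest x) * F x * (𝟙 (R u) * 𝟙 (H x u)))
        ≡⟨ sum-cong-≗ (λ x → *-distribˡ-sum (𝟙 (rest x) * F x) (λ u → 𝟙 (R u) * 𝟙 (H x u))) ⟨
      ∑[ x < n ] (𝟙 (rest x) * F x * degIn R x)
        ≡⟨ sum-cong-≗ (λ x → *-assoc (𝟙 (rest x)) (F x) _) ⟩
      weight rest (λ x → F x * degIn R x) ∎
      where
      open ≡-Reasoning
      reorder : ∀ u x → 𝟙 (R u) * (𝟙 (N-rest u x) * F x) ≡ 𝟙 (rest x) * F x * (𝟙 (R u) * 𝟙 (H x u))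
      reorder u x rewrite 𝟙-∧ (H u x) (rest x) | adj-sym (G [ W ]) u x =
        solve 4 (λ r h e f → r :* (h :* e :* f) := e :* f :* (r :* h)) refl (𝟙 (R u)) (𝟙 (H x u)) (𝟙 (rest x)) (F x)

    -- paths₂ R counts the edges ux of H with u ∈ R and x ∈ rest, paths₃ R the paths uxy of H
    -- with moreover y ∈ V.
    paths₂ paths₃ : (Fin n → Bool) → ℕ
    paths₂ R = weight R (card ∘ N-rest)
    paths₃ R = weight R (λ u → weight (N-rest u) (degIn V))

    -- Some u ∈ R has neighbors in rest whose average degIn V is at least paths₃ R / paths₂ R;
    -- keep the k best of them.
    ∃-heavy-neighborhood : ∀ R → R ⊆ W → 0 < paths₃ R →
      ∃ λ u → R u ≡ true × ∃ λ U → U ⊆ N-rest u × card U ≡ k × k * paths₃ R ≤ weight U (degIn V) * paths₂ R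
    ∃-heavy-neighborhood R R⊆W paths>0
      with ∃-member-ratio≥ R (λ u → weight (N-rest u) (degIn V)) (card ∘ N-rest) paths>0
    ... | u , Ru , u-dense with ∃-heavy-subset (degIn V) k (N-rest u) (k≤card-N-rest u (R⊆W u Ru))
    ...   | U , U⊆N-rest , |U|≡k , U-heavy = u , Ru , U , U⊆N-rest , |U|≡k ,
      ratio-transfer k (card (N-rest u)) _ _ _ _ (k≤card-N-rest u (R⊆W u Ru)) u-dense U-heavy

    weight-degIn≤crossEdges : ∀ U R → weight U (degIn R) ≤ crossEdges G U R
    weight-degIn≤crossEdges U R = begin
      ∑[ x < n ] (𝟙 (U x) * ∑[ y < n ] (𝟙 (R y) * 𝟙 (H x y)))
        ≡⟨ sum-cong-≗ (λ x → *-distribˡ-sum (𝟙 (U x)) (λ y → 𝟙 (R y) * 𝟙 (H x y))) ⟩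
      ∑[ x < n ] ∑[ y < n ] (𝟙 (U x) * (𝟙 (R y) * 𝟙 (H x y)))
        ≤⟨ sum-mono-≤ (λ x → sum-mono-≤ (pointwise x)) ⟩
      crossEdges G U R ∎
      where
      open ≤-Reasoning
      pointwise : ∀ x y → 𝟙 (U x) * (𝟙 (R y) * 𝟙 (H x y)) ≤ 𝟙 (U x ∧ R y ∧ adj G x y)
      pointwise x y with U x | R y | H x y in Hxy
      ... | false | _     | _     = z≤n
      ... | true  | false | _     = z≤n
      ... | true  | true  | false = z≤n
      ... | true  | true  | true  rewrite proj₂ (proj₂ (adj-[]⁻ G W Hxy)) = ≤-refl

    N-rest⁻ : ∀ {u x} → N-rest u x ≡ true → adj G u x ≡ true × x ≢ v × V x ≡ false
    N-rest⁻ {u} {x} e with H u x in Hux | x ≟ v | V x | e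
    ... | true  | no x≢v | false | _  = proj₂ (proj₂ (adj-[]⁻ G W Hux)) , x≢v , refl
    ... | true  | no _   | true  | ()
    ... | true  | yes _  | _     | ()
    ... | false | _      | _     | ()

    sub-bineighborhoods : ∀ {u U V′} → U ⊆ N-rest u → V′ ⊆ V → V′ u ≡ false → SubBineighborhoods G u v U V′
    sub-bineighborhoods {u} {U} {V′} U⊆N-rest V′⊆V u∉V′ = record
      { U⊆N[u]∖v = λ x Ux → proj₁ (N-rest⁻ (U⊆N-rest x Ux)) , proj₁ (proj₂ (N-rest⁻ (U⊆N-rest x Ux)))
      ; V⊆N[v]∖u = λ y V′y → proj₂ (proj₂ (adj-[]⁻ G W (V⊆N[v] y (V′⊆V y V′y))))
                           , λ { refl → Bool.not-¬ V′y u∉V′ }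
      ; disjoint  = λ x Ux V′x → Bool.not-¬ (V′⊆V x V′x) (proj₂ (proj₂ (N-rest⁻ (U⊆N-rest x Ux))))
      }

    ∣U∪V′∣≤2k : (U V′ : Fin n → Bool) → card U ≤ k → card V′ ≤ k → ∣ tabulate U ∪ tabulate V′ ∣ ≤ 2 * k
    ∣U∪V′∣≤2k U V′ |U|≤k |V′|≤k = begin
      ∣ tabulate U ∪ tabulate V′ ∣   ≤⟨ ∣tabulate∪tabulate∣≤ U V′ ⟩
      card U + card V′               ≤⟨ +-mono-≤ |U|≤k |V′|≤k ⟩
      k + k                          ≡⟨ cong (k +_) (+-identityʳ k) ⟨
      2 * k                          ∎
      where open ≤-Reasoning

    W∖V : Fin n → Bool
    W∖V u = W u ∧ not (V u)

    W∖V⁻ : ∀ {u} → W∖V u ≡ true → W u ≡ true × V u ≡ false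
    W∖V⁻ {u} e with W u | V u | e
    ... | true  | false | _  = refl , refl
    ... | true  | true  | ()
    ... | false | _     | ()

    W∖V⊆W : W∖V ⊆ W
    W∖V⊆W u = proj₁ ∘ W∖V⁻

    degIn-outside : ∀ R {x} → W x ≡ false → degIn R x ≡ 0
    degIn-outside R {x} Wx≡false = trans (sum-cong-≗ no-edge) (sum-replicate-zero n)
      where
      no-edge : ∀ y → 𝟙 (R y) * 𝟙 (H x y) ≡ 0
      no-edge y with H x y in Hxy
      ... | false = *-zeroʳ (𝟙 (R y))
      ... | true  with () ← trans (sym Wx≡false) (proj₁ (adj-[]⁻ G W Hxy))

    k≤degIn-W∖V : ∀ x → W x ≡ true → k ≤ degIn W∖V x
    k≤degIn-W∖V x Wx = +-cancelʳ-≤ k _ _ (begin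
      k + k                                     ≤⟨ n≤1+n _ ⟩
      suc (k + k)                               ≡⟨ cong suc (cong (k +_) (+-identityʳ k)) ⟨
      suc (2 * k)                               ≤⟨ minDegree x Wx ⟩
      degree (G [ W ]) x                        ≤⟨ sum-mono-≤ split ⟩
      ∑[ u < n ] (𝟙 (W∖V u) * 𝟙 (H x u) + 𝟙 (V u))  ≡⟨ ∑-distrib-+ (λ u → 𝟙 (W∖V u) * 𝟙 (H x u)) _ ⟩
      degIn W∖V x + card V                      ≡⟨ cong (degIn W∖V x +_) |V|≡k ⟩
      degIn W∖V x + k                           ∎)
      where
      open ≤-Reasoning
      split : ∀ u → 𝟙 (H x u) ≤ 𝟙 (W∖V u) * 𝟙 (H x u) + 𝟙 (V u)
      split u with H x u in Hxu
      ... | false = z≤n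
      ... | true  rewrite proj₁ (proj₂ (adj-[]⁻ G W Hxu)) with V u
      ...   | true  = s≤s z≤n
      ...   | false = s≤s z≤n

    k³≤paths₃-W∖V : k * k * k ≤ paths₃ W∖V
    k³≤paths₃-W∖V = begin
      k * k * k                                      ≤⟨ *-monoˡ-≤ k k*k≤weight-rest ⟩
      weight rest (degIn V) * k                      ≡⟨ *-distribʳ-sum k (λ x → 𝟙 (rest x) * degIn V x) ⟩
      ∑[ x < n ] (𝟙 (rest x) * degIn V x * k)        ≡⟨ sum-cong-≗ (λ x → *-assoc (𝟙 (rest x)) (degIn V x) k) ⟩
      weight rest (λ x → degIn V x * k)              ≤⟨ weight-mono-≤ rest (λ x _ → pointwise x) ⟩
      weight rest (λ x → degIn V x * degIn W∖V x)    ≡⟨ weight-N-rest-swap W∖V (degIn V) ⟨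
      paths₃ W∖V                                     ∎
      where
      open ≤-Reasoning
      pointwise : ∀ x → degIn V x * k ≤ degIn V x * degIn W∖V x
      pointwise x with W x Bool.≟ true
      ... | yes Wx = *-monoʳ-≤ (degIn V x) (k≤degIn-W∖V x Wx)
      ... | no  x∉W = subst (λ t → t * k ≤ t * degIn W∖V x) (sym (degIn-outside V (Bool.¬-not x∉W))) z≤n

    paths₂-W∖V≤degreeSum : paths₂ W∖V ≤ degreeSum G
    paths₂-W∖V≤degreeSum =
      ≤-trans (weight≤sum W∖V (card ∘ N-rest)) (sum-mono-≤ (λ u → card-mono (λ x → proj₁ ∘ N-rest⁻ {u} {x})))

    paths₃-W∖V>0 : 0 < k → 0 < paths₃ W∖V
    paths₃-W∖V>0 k>0 = <-≤-trans (*-mono-< (*-mono-< k>0 k>0) k>0) k³≤paths₃-W∖V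

    k⁴≤degreeSum*crossEdges : ∀ U → k * paths₃ W∖V ≤ weight U (degIn V) * paths₂ W∖V →
      k * k * k * k ≤ degreeSum G * crossEdges G U V
    k⁴≤degreeSum*crossEdges U U-heavy = begin
      k * k * k * k                                   ≡⟨ *-comm (k * k * k) k ⟩
      k * (k * k * k)                                 ≤⟨ *-monoʳ-≤ k k³≤paths₃-W∖V ⟩
      k * paths₃ W∖V                                  ≤⟨ U-heavy ⟩
      weight U (degIn V) * paths₂ W∖V                 ≤⟨ *-mono-≤ (weight-degIn≤crossEdges U V) paths₂-W∖V≤degreeSum ⟩
      crossEdges G U V * degreeSum G                  ≡⟨ *-comm (crossEdges G U V) (degreeSum G) ⟩
      degreeSum G * crossEdges G U V                  ∎
      where open ≤-Reasoning

    ∃-dense-sub-bineighborhoods : 0 < k →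
      ∃ λ u → ∃ λ U → SubBineighborhoods G u v U V × ∣ tabulate U ∪ tabulate V ∣ ≤ 2 * k ×
        k * k * k * k ≤ 2 * numEdges G * crossEdges G U V
    ∃-dense-sub-bineighborhoods k>0 =
      let u , u∈W∖V , U , U⊆N-rest , |U|≡k , U-heavy = ∃-heavy-neighborhood W∖V W∖V⊆W (paths₃-W∖V>0 k>0)
      in u , U , sub-bineighborhoods {u} {U} {V} U⊆N-rest (λ _ Vy → Vy) (proj₂ (W∖V⁻ u∈W∖V)) ,
         ∣U∪V′∣≤2k U V (≤-reflexive |U|≡k) (≤-reflexive |V|≡k) ,
         subst (λ t → k * k * k * k ≤ t * crossEdges G U V) (degreeSum≡2*numEdges G) (k⁴≤degreeSum*crossEdges U U-heavy)

    paths₂-V≡ : paths₂ V ≡ weight rest (degIn V)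
    paths₂-V≡ = begin
      weight V (card ∘ N-rest)
        ≡⟨ sum-cong-≗ (λ u → cong (𝟙 (V u) *_) (card≡weight-1 (N-rest u))) ⟩
      weight V (λ u → weight (N-rest u) (λ _ → 1))
        ≡⟨ weight-N-rest-swap V (λ _ → 1) ⟩
      weight rest (λ x → 1 * degIn V x)
        ≡⟨ sum-cong-≗ (λ x → cong (𝟙 (rest x) *_) (*-identityˡ (degIn V x))) ⟩
      weight rest (degIn V) ∎
      where open ≡-Reasoning

    paths₂²≤n*paths₃ : paths₂ V * paths₂ V ≤ n * paths₃ V
    paths₂²≤n*paths₃ = begin
      paths₂ V * paths₂ V                                 ≡⟨ cong (λ t → t * t) paths₂-V≡ ⟩
      weight rest (degIn V) * weight rest (degIn V)       ≤⟨ cauchy-schwarz (λ x → 𝟙 (rest x) * degIn V x) ⟩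
      n * ∑[ x < n ] (𝟙 (rest x) * degIn V x * (𝟙 (rest x) * degIn V x))
        ≡⟨ cong (n *_) (sum-cong-≗ (λ x → 𝟙-idem (rest x) (degIn V x))) ⟩
      n * weight rest (λ x → degIn V x * degIn V x)       ≡⟨ cong (n *_) (weight-N-rest-swap V (degIn V)) ⟨
      n * paths₃ V                                        ∎
      where
      open ≤-Reasoning
      𝟙-idem : ∀ b d → 𝟙 b * d * (𝟙 b * d) ≡ 𝟙 b * (d * d)
      𝟙-idem true  d = solve 1 (λ d → con 1 :* d :* (con 1 :* d) := con 1 :* (d :* d)) refl d
      𝟙-idem false d = refl

    paths₂-V>0 : 0 < k → 0 < paths₂ V
    paths₂-V>0 k>0 = <-≤-trans (*-mono-< k>0 k>0) (subst (k * k ≤_) (sym paths₂-V≡) k*k≤weight-rest)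

    paths₃-V>0 : 0 < k → 0 < paths₃ V
    paths₃-V>0 k>0 = n≢0⇒n>0 λ paths₃≡0 → <-irrefl refl (begin-strict
      0                        <⟨ *-mono-< (paths₂-V>0 k>0) (paths₂-V>0 k>0) ⟩
      paths₂ V * paths₂ V      ≤⟨ paths₂²≤n*paths₃ ⟩
      n * paths₃ V             ≡⟨ cong (n *_) paths₃≡0 ⟩
      n * 0                    ≡⟨ *-zeroʳ n ⟩
      0                        ∎)
      where open ≤-Reasoning

    k*paths₂≤n*weight : ∀ {y} → 0 < k → k * paths₃ V ≤ y * paths₂ V → k * paths₂ V ≤ n * y
    k*paths₂≤n*weight {y} k>0 heavy = *-cancelʳ-≤ _ _ (paths₂ V) ⦃ >-nonZero (paths₂-V>0 k>0) ⦄ (begin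
      k * paths₂ V * paths₂ V       ≡⟨ *-assoc k (paths₂ V) (paths₂ V) ⟩
      k * (paths₂ V * paths₂ V)     ≤⟨ *-monoʳ-≤ k paths₂²≤n*paths₃ ⟩
      k * (n * paths₃ V)            ≡⟨ solve 3 (λ k n p → k :* (n :* p) := n :* (k :* p)) refl k n (paths₃ V) ⟩
      n * (k * paths₃ V)            ≤⟨ *-monoʳ-≤ n heavy ⟩
      n * (y * paths₂ V)            ≡⟨ *-assoc n y (paths₂ V) ⟨
      n * y * paths₂ V              ∎)
      where open ≤-Reasoning

    weight-degIn≤crossEdges-─ : ∀ U {u} → V u ≡ true → weight U (degIn V) ≤ crossEdges G U (V ─ u) + card U
    weight-degIn≤crossEdges-─ U {u} Vu = begin
      weight U (degIn V)
        ≤⟨ weight-mono-≤ U (λ x _ → degIn-─ x) ⟩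
      ∑[ x < n ] (𝟙 (U x) * (degIn (V ─ u) x + 1))
        ≡⟨ sum-cong-≗ (λ x → *-distribˡ-+ (𝟙 (U x)) (degIn (V ─ u) x) 1) ⟩
      ∑[ x < n ] (𝟙 (U x) * degIn (V ─ u) x + 𝟙 (U x) * 1)
        ≡⟨ ∑-distrib-+ (λ x → 𝟙 (U x) * degIn (V ─ u) x) _ ⟩
      weight U (degIn (V ─ u)) + weight U (λ _ → 1)
        ≤⟨ +-mono-≤ (weight-degIn≤crossEdges U (V ─ u)) (≤-reflexive (sym (card≡weight-1 U))) ⟩
      crossEdges G U (V ─ u) + card U ∎
      where
      open ≤-Reasoning
      degIn-─ : ∀ x → degIn V x ≤ degIn (V ─ u) x + 1
      degIn-─ x = ≤-trans (≤-reflexive (weight-─ V Vu (𝟙 ∘ H x))) (+-monoʳ-≤ (degIn (V ─ u) x) (𝟙≤1 (H x u)))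

    k³≤n*[crossEdges+k] : ∀ {u} U → V u ≡ true → card U ≡ k → 0 < k →
      k * paths₃ V ≤ weight U (degIn V) * paths₂ V → k * k * k ≤ n * (crossEdges G U (V ─ u) + k)
    k³≤n*[crossEdges+k] {u} U Vu |U|≡k k>0 U-heavy = begin
      k * k * k                                  ≡⟨ *-assoc k k k ⟩
      k * (k * k)                                ≤⟨ *-monoʳ-≤ k (subst (k * k ≤_) (sym paths₂-V≡) k*k≤weight-rest) ⟩
      k * paths₂ V                               ≤⟨ k*paths₂≤n*weight k>0 U-heavy ⟩
      n * weight U (degIn V)                     ≤⟨ *-monoʳ-≤ n (weight-degIn≤crossEdges-─ U Vu) ⟩
      n * (crossEdges G U (V ─ u) + card U)      ≡⟨ cong (λ t → n * (crossEdges G U (V ─ u) + t)) |U|≡k ⟩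
      n * (crossEdges G U (V ─ u) + k)           ∎
      where open ≤-Reasoning

    ∃-dense-adjacent-sub-bineighborhoods : 0 < k →
      ∃ λ u → adj G u v ≡ true × ∃ λ U → SubBineighborhoods G u v U (V ─ u) ×
        ∣ tabulate U ∪ tabulate (V ─ u) ∣ ≤ 2 * k × k * k * k ≤ n * (crossEdges G U (V ─ u) + k)
    ∃-dense-adjacent-sub-bineighborhoods k>0 =
      let u , Vu , U , U⊆N-rest , |U|≡k , U-heavy = ∃-heavy-neighborhood V V⊆W (paths₃-V>0 k>0)
      in u , trans (adj-sym G u v) (proj₂ (proj₂ (adj-[]⁻ G W (V⊆N[v] u Vu)))) ,
         U , sub-bineighborhoods {u} {U} {V ─ u} U⊆N-rest (─-⊆ V u) (x∉P─x V u) ,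
         ∣U∪V′∣≤2k U (V ─ u) (≤-reflexive |U|≡k) (subst (card (V ─ u) ≤_) |V|≡k (card-mono (─-⊆ V u))) ,
         k³≤n*[crossEdges+k] U Vu |U|≡k k>0 U-heavy

  -- Arithmetic

  -- k = ⌊(m − n)/2n⌋; m ≥ 8n gives k ≥ 3, which is what m < (2k + 3)n ≤ 3kn needs.
  ∃-core-parameter : ∀ m n → .{{_ : NonZero n}} → 8 * n ≤ m →
    ∃ λ k → 0 < k × suc (2 * k) * n ≤ m × m ≤ 3 * k * n
  ∃-core-parameter m n 8n≤m = k , <-≤-trans z<s 3≤k , lower , upper
    where
    open ≤-Reasoning
    instance
      2n≢0 : NonZero (2 * n)
      2n≢0 = m*n≢0 2 n
    k r : ℕ
    k = (m ∸ n) / (2 * n)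
    r = (m ∸ n) % (2 * n)
    m≡ : m ≡ r + k * (2 * n) + n
    m≡ = trans (sym (m∸n+n≡m (≤-trans (m≤n*m n 8) 8n≤m))) (cong (_+ n) (m≡m%n+[m/n]*n (m ∸ n) (2 * n)))
    3≤k : 3 ≤ k
    3≤k = begin
      3                          ≡⟨ m*n/n≡m 3 (2 * n) ⟨
      3 * (2 * n) / (2 * n)      ≤⟨ /-monoˡ-≤ (2 * n) (+-cancelʳ-≤ n _ _ (begin
        3 * (2 * n) + n            ≤⟨ ≤-reflexive (solve 1 (λ n → con 3 :* (con 2 :* n) :+ n := con 7 :* n) refl n) ⟩
        7 * n                      ≤⟨ *-monoˡ-≤ n (n≤1+n 7) ⟩
        8 * n                      ≤⟨ 8n≤m ⟩
        m                          ≡⟨ m∸n+n≡m (≤-trans (m≤n*m n 8) 8n≤m) ⟨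
        m ∸ n + n                  ∎)) ⟩
      k                          ∎
    lower : suc (2 * k) * n ≤ m
    lower = begin
      suc (2 * k) * n
        ≡⟨ solve 2 (λ k n → (con 1 :+ con 2 :* k) :* n := con 0 :+ k :* (con 2 :* n) :+ n) refl k n ⟩
      0 + k * (2 * n) + n
        ≤⟨ +-monoˡ-≤ n (+-monoˡ-≤ (k * (2 * n)) z≤n) ⟩
      r + k * (2 * n) + n
        ≡⟨ m≡ ⟨
      m ∎
    upper : m ≤ 3 * k * n
    upper = begin
      m
        ≡⟨ m≡ ⟩
      r + k * (2 * n) + n
        ≤⟨ +-monoˡ-≤ n (+-monoˡ-≤ (k * (2 * n)) (<⇒≤ (m%n<n (m ∸ n) (2 * n)))) ⟩
      2 * n + k * (2 * n) + n
        ≡⟨ solve 2 (λ k n → con 2 :* n :+ k :* (con 2 :* n) :+ n := (con 3 :+ con 2 :* k) :* n) refl k n ⟩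
      (3 + 2 * k) * n
        ≤⟨ *-monoˡ-≤ n (+-monoˡ-≤ (2 * k) 3≤k) ⟩
      (k + 2 * k) * n
        ≡⟨ solve 2 (λ k n → (k :+ con 2 :* k) :* n := con 3 :* k :* n) refl k n ⟩
      3 * k * n ∎

  -- Passing to ℚ

  toℚᵘ-frac : ∀ a b → ℚ.toℚᵘ (ℤ.+ a ℚ./ suc b) ℚᵘ.≃ ℚᵘ.mkℚᵘ (ℤ.+ a) b
  toℚᵘ-frac a b = ℚ.toℚᵘ-fromℚᵘ (ℚᵘ.mkℚᵘ (ℤ.+ a) b)

  frac-mono-≤ : ∀ a b c d → a * suc d ≤ c * suc b → ℤ.+ a ℚ./ suc b ℚ.≤ ℤ.+ c ℚ./ suc d
  frac-mono-≤ a b c d ad≤cb = ℚ.toℚᵘ-cancel-≤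
    (ℚᵘ.≤-respˡ-≃ (ℚᵘ.≃-sym (toℚᵘ-frac a b)) (ℚᵘ.≤-respʳ-≃ (ℚᵘ.≃-sym (toℚᵘ-frac c d))
      (ℚᵘ.*≤* (subst₂ ℤ._≤_ (ℤ.pos-* a (suc d)) (ℤ.pos-* c (suc b)) (ℤ.+≤+ ad≤cb)))))

  frac-cancel-≤ : ∀ a b c d → ℤ.+ a ℚ./ suc b ℚ.≤ ℤ.+ c ℚ./ suc d → a * suc d ≤ c * suc b
  frac-cancel-≤ a b c d a/b≤c/d = ℤ.drop‿+≤+
    (subst₂ ℤ._≤_ (sym (ℤ.pos-* a (suc d))) (sym (ℤ.pos-* c (suc b)))
      (ℚᵘ.drop-*≤* (ℚᵘ.≤-respˡ-≃ (toℚᵘ-frac a b)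
        (ℚᵘ.≤-respʳ-≃ (toℚᵘ-frac c d) (ℚ.toℚᵘ-mono-≤ a/b≤c/d)))))

  frac-*-frac : ∀ a b c d → (ℤ.+ a ℚ./ suc b) ℚ.* (ℤ.+ c ℚ./ suc d) ≡ ℤ.+ (a * c) ℚ./ (suc b * suc d)
  frac-*-frac a b c d = ℚ.toℚᵘ-injective (begin
    ℚ.toℚᵘ ((ℤ.+ a ℚ./ suc b) ℚ.* (ℤ.+ c ℚ./ suc d))
      ≈⟨ ℚ.toℚᵘ-homo-* (ℤ.+ a ℚ./ suc b) (ℤ.+ c ℚ./ suc d) ⟩
    ℚ.toℚᵘ (ℤ.+ a ℚ./ suc b) ℚᵘ.* ℚ.toℚᵘ (ℤ.+ c ℚ./ suc d)
      ≈⟨ ℚᵘ.*-cong (toℚᵘ-frac a b) (toℚᵘ-frac c d) ⟩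
    ℚᵘ.mkℚᵘ (ℤ.+ a ℤ.* ℤ.+ c) (d + b * suc d)
      ≈⟨ ℚᵘ.*≡* (cong (ℤ._* ℤ.+ (suc b * suc d)) (sym (ℤ.pos-* a c))) ⟩
    ℚᵘ.mkℚᵘ (ℤ.+ (a * c)) (d + b * suc d)
      ≈⟨ toℚᵘ-frac (a * c) _ ⟨
    ℚ.toℚᵘ (ℤ.+ (a * c) ℚ./ (suc b * suc d)) ∎)
    where open ℚᵘ.≃-Reasoning

  d³≤X*n*f[2d] : ∀ (f : ℚ → ℚ) → Nondecreasing f → ∀ a n X e j →
    j * suc n ≤ 2 * a → a * a * a ≤ X * e * (suc n * suc n * suc n * suc n) → ℕtoℚ e ℚ.≤ f (ℕtoℚ j) →
    let d = ℤ.+ a ℚ./ suc n in d ℚ.* d ℚ.* d ℚ.≤ ℕtoℚ X ℚ.* ℕtoℚ (suc n) ℚ.* f (ℕtoℚ 2 ℚ.* d)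
  d³≤X*n*f[2d] f f-mono a n X e j j≤2d a³≤Xen⁴ e≤f[j] = begin
    d ℚ.* d ℚ.* d
      ≡⟨ trans (cong (ℚ._* d) (frac-*-frac a n a n)) (frac-*-frac (a * a) _ a n) ⟩
    ℤ.+ (a * a * a) ℚ./ (sn * sn * sn)
      ≤⟨ frac-mono-≤ (a * a * a) _ (X * sn * e) 0 cross ⟩
    ℤ.+ (X * sn * e) ℚ./ 1
      ≡⟨ trans (cong (ℚ._* ℕtoℚ e) (frac-*-frac X 0 sn 0)) (frac-*-frac (X * sn) 0 e 0) ⟨
    ℕtoℚ X ℚ.* ℕtoℚ sn ℚ.* ℕtoℚ e
      ≤⟨ ℚ.*-monoˡ-≤-nonNeg (ℕtoℚ X ℚ.* ℕtoℚ sn) ⦃ Xn≥0 ⦄ (ℚ.≤-trans e≤f[j] (f-mono _ _ j≤2d′)) ⟩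
    ℕtoℚ X ℚ.* ℕtoℚ sn ℚ.* f (ℕtoℚ 2 ℚ.* d) ∎
    where
    open ℚ.≤-Reasoning
    sn : ℕ
    sn = suc n
    d : ℚ
    d = ℤ.+ a ℚ./ sn
    cross : a * a * a * 1 ≤ X * sn * e * (sn * sn * sn)
    cross = subst₂ _≤_ (sym (*-identityʳ _))
      (solve 3 (λ X e s → X :* e :* (s :* s :* s :* s) := X :* s :* e :* (s :* s :* s)) refl X e sn) a³≤Xen⁴
    -- frac-*-frac gives the denominator 1 * suc n, which reduces only to suc (n + 0)
    2*d≡ : ℕtoℚ 2 ℚ.* d ≡ ℤ.+ (2 * a) ℚ./ sn
    2*d≡ = subst (λ t → ℕtoℚ 2 ℚ.* d ≡ ℤ.+ (2 * a) ℚ./ suc t) (+-identityʳ n) (frac-*-frac 2 0 a n)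
    j≤2d′ : ℕtoℚ j ℚ.≤ ℕtoℚ 2 ℚ.* d
    j≤2d′ = subst (ℕtoℚ j ℚ.≤_) (sym 2*d≡) (frac-mono-≤ j 0 (2 * a) n (subst (j * sn ≤_) (sym (*-identityʳ _)) j≤2d))
    Xn≥0 : ℚ.NonNegative (ℕtoℚ X ℚ.* ℕtoℚ sn)
    Xn≥0 = subst ℚ.NonNegative (sym (frac-*-frac X 0 sn 0)) (ℚ.normalize-nonNeg (X * sn) 1)

  8m³≤2¹¹en⁴ : ∀ m n k e → m ≤ 3 * k * n → k * k * k * k ≤ 2 * m * e →
    2 * m * (2 * m) * (2 * m) ≤ 2 ^ 11 * e * (n * n * n * n)
  8m³≤2¹¹en⁴ zero    n k e _      _      = z≤n
  8m³≤2¹¹en⁴ m@(suc _) n k e m≤3kn k⁴≤2me = begin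
    2 * m * (2 * m) * (2 * m)
      ≡⟨ solve 1 (λ m → con 2 :* m :* (con 2 :* m) :* (con 2 :* m) := con 8 :* (m :* m :* m)) refl m ⟩
    8 * (m * m * m)
      ≤⟨ *-monoʳ-≤ 8 m³≤162en⁴ ⟩
    8 * (162 * e * (n * n * n * n))
      ≤⟨ ≤-reflexive (solve 2 (λ e n → con 8 :* (con 162 :* e :* n) := con 1296 :* e :* n) refl e (n * n * n * n)) ⟩
    1296 * e * (n * n * n * n)
      ≤⟨ *-monoˡ-≤ (n * n * n * n) (*-monoˡ-≤ e (m≤m+n 1296 752)) ⟩
    2 ^ 11 * e * (n * n * n * n) ∎
    where
    open ≤-Reasoning
    m³≤162en⁴ : m * m * m ≤ 162 * e * (n * n * n * n)
    m³≤162en⁴ = *-cancelˡ-≤ m (begin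
      m * (m * m * m)
        ≡⟨ solve 1 (λ m → m :* (m :* m :* m) := m :* m :* m :* m) refl m ⟩
      m * m * m * m
        ≤⟨ *-mono-≤ (*-mono-≤ (*-mono-≤ m≤3kn m≤3kn) m≤3kn) m≤3kn ⟩
      3 * k * n * (3 * k * n) * (3 * k * n) * (3 * k * n)
        ≡⟨ solve 2 (λ k n → con 3 :* k :* n :* (con 3 :* k :* n) :* (con 3 :* k :* n) :* (con 3 :* k :* n)
                         := con 81 :* (k :* k :* k :* k) :* (n :* n :* n :* n)) refl k n ⟩
      81 * (k * k * k * k) * (n * n * n * n)
        ≤⟨ *-monoˡ-≤ (n * n * n * n) (*-monoʳ-≤ 81 k⁴≤2me) ⟩
      81 * (2 * m * e) * (n * n * n * n)
        ≡⟨ solve 3 (λ m e n → con 81 :* (con 2 :* m :* e) :* n := m :* (con 162 :* e :* n)) refl m e (n * n * n * n) ⟩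
      m * (162 * e * (n * n * n * n)) ∎)

  8m³≤2²⁰en⁴ : ∀ m n k e → 0 < n → m ≤ 3 * k * n → 625 * n ^ 3 ≤ m ^ 2 → k * k * k ≤ n * (e + k) →
    2 * m * (2 * m) * (2 * m) ≤ 2 ^ 20 * e * (n * n * n * n)
  8m³≤2²⁰en⁴ m n k e n>0 m≤3kn 625n³≤m² k³≤n[e+k] = begin
    2 * m * (2 * m) * (2 * m)
      ≡⟨ solve 1 (λ m → con 2 :* m :* (con 2 :* m) :* (con 2 :* m) := con 8 :* (m :* m :* m)) refl m ⟩
    8 * (m * m * m)
      ≤⟨ *-monoʳ-≤ 8 (*-mono-≤ (*-mono-≤ m≤3kn m≤3kn) m≤3kn) ⟩
    8 * (3 * k * n * (3 * k * n) * (3 * k * n))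
      ≡⟨ solve 2 (λ k n → con 8 :* (con 3 :* k :* n :* (con 3 :* k :* n) :* (con 3 :* k :* n))
                       := con 216 :* (k :* k :* k) :* (n :* n :* n)) refl k n ⟩
    216 * (k * k * k) * (n * n * n)
      ≤⟨ *-monoˡ-≤ (n * n * n) (*-monoʳ-≤ 216 k³≤2ne) ⟩
    216 * (2 * n * e) * (n * n * n)
      ≡⟨ solve 2 (λ e n → con 216 :* (con 2 :* n :* e) :* (n :* n :* n) := con 432 :* e :* (n :* n :* n :* n)) refl e n ⟩
    432 * e * (n * n * n * n)
      ≤⟨ *-monoˡ-≤ (n * n * n * n) (*-monoˡ-≤ e (m≤m+n 432 (2 ^ 20 ∸ 432))) ⟩
    2 ^ 20 * e * (n * n * n * n) ∎
    where
    open ≤-Reasoning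
    625n≤9k² : 625 * n ≤ 9 * (k * k)
    625n≤9k² = *-cancelˡ-≤ (n * n) ⦃ >-nonZero (*-mono-< n>0 n>0) ⦄ (begin
      n * n * (625 * n)
        ≡⟨ solve 1 (λ n → n :* n :* (con 625 :* n) := con 625 :* n :^ 3) refl n ⟩
      625 * n ^ 3
        ≤⟨ 625n³≤m² ⟩
      m ^ 2
        ≡⟨ solve 1 (λ m → m :^ 2 := m :* m) refl m ⟩
      m * m
        ≤⟨ *-mono-≤ m≤3kn m≤3kn ⟩
      3 * k * n * (3 * k * n)
        ≡⟨ solve 2 (λ k n → con 3 :* k :* n :* (con 3 :* k :* n) := n :* n :* (con 9 :* (k :* k))) refl k n ⟩
      n * n * (9 * (k * k)) ∎)
    2n≤k² : 2 * n ≤ k * k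
    2n≤k² = *-cancelˡ-≤ 9 (begin
      9 * (2 * n)     ≡⟨ *-assoc 9 2 n ⟨
      18 * n          ≤⟨ *-monoˡ-≤ n (m≤m+n 18 607) ⟩
      625 * n         ≤⟨ 625n≤9k² ⟩
      9 * (k * k)     ∎)
    k³≤2ne : k * k * k ≤ 2 * n * e
    k³≤2ne = +-cancelʳ-≤ (k * k * k) _ _ (begin
      k * k * k + k * k * k
        ≡⟨ solve 1 (λ k → k :* k :* k :+ k :* k :* k := con 2 :* (k :* k :* k)) refl k ⟩
      2 * (k * k * k)
        ≤⟨ *-monoʳ-≤ 2 k³≤n[e+k] ⟩
      2 * (n * (e + k))
        ≡⟨ solve 3 (λ n e k → con 2 :* (n :* (e :+ k)) := con 2 :* n :* e :+ con 2 :* n :* k) refl n e k ⟩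
      2 * n * e + 2 * n * k
        ≤⟨ +-monoʳ-≤ (2 * n * e) (*-monoˡ-≤ k 2n≤k²) ⟩
      2 * n * e + k * k * k ∎)

  16≤avgDeg⇒8n≤m : ∀ {n} (G : Graph (suc n)) → ℕtoℚ 16 ℚ.≤ avgDeg G → 8 * suc n ≤ numEdges G
  16≤avgDeg⇒8n≤m {n} G 16≤d̄ = *-cancelˡ-≤ 2 (begin
    2 * (8 * suc n)           ≡⟨ *-assoc 2 8 (suc n) ⟨
    16 * suc n                ≤⟨ frac-cancel-≤ 16 0 (2 * numEdges G) n 16≤d̄ ⟩
    2 * numEdges G * 1        ≡⟨ *-identityʳ _ ⟩
    2 * numEdges G            ∎)
    where open ≤-Reasoning

  j*n≤2*[2m] : ∀ {j n m} k → j ≤ 2 * k → suc (2 * k) * n ≤ m → j * n ≤ 2 * (2 * m)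
  j*n≤2*[2m] {j} {n} {m} k j≤2k [2k+1]n≤m = begin
    j * n                  ≤⟨ *-monoˡ-≤ n (≤-trans j≤2k (n≤1+n _)) ⟩
    suc (2 * k) * n        ≤⟨ [2k+1]n≤m ⟩
    m                      ≤⟨ m≤m+n m _ ⟩
    2 * m                  ≤⟨ m≤m+n (2 * m) _ ⟩
    2 * (2 * m)            ∎
    where open ≤-Reasoning

  module Bounds (f : ℚ → ℚ) (f-mono : Nondecreasing f) {n} (G : Graph (suc n)) {k} (k>0 : 0 < k)
    ([2k+1]n≤m : suc (2 * k) * suc n ≤ numEdges G) (m≤3kn : numEdges G ≤ 3 * k * suc n) (core : Core G k) where

    open Counting core

    all-pairs-bound : (∀ u v → SparseSubBineighborhoods f G u v) →
      avgDeg G ℚ.* avgDeg G ℚ.* avgDeg G ℚ.≤ ℕtoℚ (2 ^ 11) ℚ.* ℕtoℚ (suc n) ℚ.* f (ℕtoℚ 2 ℚ.* avgDeg G)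
    all-pairs-bound sparse = case ∃-dense-sub-bineighborhoods k>0 of λ where
      (u , U , U-V , ∣U∪V∣≤2k , k⁴≤2me) →
        d³≤X*n*f[2d] f f-mono (2 * numEdges G) n (2 ^ 11) (crossEdges G U V) ∣ tabulate U ∪ tabulate V ∣
          (j*n≤2*[2m] k ∣U∪V∣≤2k [2k+1]n≤m)
          (8m³≤2¹¹en⁴ (numEdges G) (suc n) k _ m≤3kn k⁴≤2me)
          (crossEdges≤f∣U∪V∣ f (sparse u v) U-V)

    adjacent-pairs-bound : (∀ u v → adj G u v ≡ true → SparseSubBineighborhoods f G u v) →
      625 * suc n ^ 3 ≤ numEdges G ^ 2 →
      avgDeg G ℚ.* avgDeg G ℚ.* avgDeg G ℚ.≤ ℕtoℚ (2 ^ 20) ℚ.* ℕtoℚ (suc n) ℚ.* f (ℕtoℚ 2 ℚ.* avgDeg G)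
    adjacent-pairs-bound sparse 625n³≤m² = case ∃-dense-adjacent-sub-bineighborhoods k>0 of λ where
      (u , uv , U , U-V′ , ∣U∪V′∣≤2k , k³≤n[e+k]) →
        d³≤X*n*f[2d] f f-mono (2 * numEdges G) n (2 ^ 20) (crossEdges G U (V ─ u)) ∣ tabulate U ∪ tabulate (V ─ u) ∣
          (j*n≤2*[2m] k ∣U∪V′∣≤2k [2k+1]n≤m)
          (8m³≤2²⁰en⁴ (numEdges G) (suc n) k _ z<s m≤3kn 625n³≤m² k³≤n[e+k])
          (crossEdges≤f∣U∪V∣ f (sparse u v uv) U-V′)


open import Defs
open import Data.Nat using (ℕ; NonZero; _^_)
import Data.Nat as ℕ
open import Data.Fin using (Fin)
open import Data.Bool using (true)
open import Data.Product using (_×_; _,_)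
open import Data.Rational using (ℚ; _≤_; _*_)
open import Relation.Binary.PropositionalEquality using (_≡_)
open import Function using (case_of_)
open Lemmas

theorem32 : (f : ℚ → ℚ) → NonNegative f → Nondecreasing f →
    (n : ℕ) → .{{_ : NonZero n}} → (G : Graph n) → Bipartite G →
    ℕtoℚ 16 ≤ avgDeg G →
    ((∀ u v → SparseSubBineighborhoods f G u v) →
      avgDeg G * avgDeg G * avgDeg G
        ≤ ℕtoℚ (2 ^ 11) * ℕtoℚ n * f (ℕtoℚ 2 * avgDeg G))
    ×
    ((∀ u v → adj G u v ≡ true → SparseSubBineighborhoods f G u v) →
      625 ℕ.* (n ^ 3) ℕ.≤ numEdges G ^ 2 →
      avgDeg G * avgDeg G * avgDeg G
        ≤ ℕtoℚ (2 ^ 20) * ℕtoℚ n * f (ℕtoℚ 2 * avgDeg G))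
theorem32 f _ f-mono ℕ.zero ⦃ () ⦄ G _ _
theorem32 f _ f-mono (ℕ.suc n) G _ 16≤d̄ =
  case ∃-core-parameter (numEdges G) (ℕ.suc n) (16≤avgDeg⇒8n≤m G 16≤d̄) of λ where
    (k , k>0 , [2k+1]n≤m , m≤3kn) →
      let open Bounds f f-mono G k>0 [2k+1]n≤m m≤3kn (∃-core G k ℕ.z<s [2k+1]n≤m)
      in all-pairs-bound , adjacent-pairs-bound
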